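{- Let $r\ge 3$ be an integer, let $G$ be an $n$-vertex graph and let $M\subset V(G)$ have size $m$, such that no copy of $K_r$ in $G$ intersects $M$. Let $\nu\in[0,1)$, and let $X$ be the set of vertices of $G$ outside $M$ having at least $\max(1,\nu n)$ neighbours in $M$. Suppose every vertex of $X$ has degree at least $n-m-\nu^2 n$. Then $|X|\le (1+\nu)(r-2)m$.
   Formalization: The parameter ν ranges only over the rationals in $[0,1)$. -}

module Defs where

open import Data.Nat using (ℕ; _∸_)
open import Data.Bool using (Bool; true; false; not; _∧_)
open import Data.Fin using (Fin)
open import Data.Fin.Subset using (Subset; _∈_; _∩_; ∣_∣)
open import Data.Vec using (tabulate; lookup)
open import Data.Integer using (+_)
open import Data.Rational using (ℚ; _/_; _≤_; _*_; _+_; 1ℚ)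
open import Data.Rational.Properties using (_≤?_)
open import Data.Product using (∃; _×_)
open import Function.Definitions using (Injective)
open import Relation.Binary.PropositionalEquality using (_≡_; _≢_)
open import Relation.Nullary.Decidable using (⌊_⌋)

record Graph (n : ℕ) : Set where
  field
    adj   : Fin n → Fin n → Bool
    sym   : ∀ i j → adj i j ≡ adj j i
    irrefl : ∀ i → adj i i ≡ false
open Graph public

ℕ→ℚ : ℕ → ℚ
ℕ→ℚ k = + k / 1

N : ∀ {n} → Graph n → Fin n → Subset n
N G i = tabulate (λ j → adj G i j)

degree : ∀ {n} → Graph n → Fin n → ℕ
degree G i = ∣ N G i ∣

degIn : ∀ {n} → Graph n → Subset n → Fin n → ℕ
degIn G M i = ∣ N G i ∩ M ∣

IsClique : ∀ {n r} → Graph n → (Fin r → Fin n) → Set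
IsClique G f = Injective _≡_ _≡_ f × (∀ a b → a ≢ b → adj G (f a) (f b) ≡ true)

KrMeets : ∀ {n} → ℕ → Graph n → Subset n → Set
KrMeets {n} r G M = ∃ λ (f : Fin r → Fin n) → IsClique G f × ∃ λ a → f a ∈ M

X : ∀ {n} → Graph n → Subset n → ℚ → Subset n
X {n} G M ν = tabulate λ i →
  not (lookup M i)
  ∧ ⌊ ℕ→ℚ 1 ≤? ℕ→ℚ (degIn G M i) ⌋
  ∧ ⌊ ν * ℕ→ℚ n ≤? ℕ→ℚ (degIn G M i) ⌋

-- Give a vertex x ∈ X the weight 1/slack(x), where slack(x) = ν²n + d_M(x) and d_M(x)
-- is its number of neighbours in M. The degree condition says that x has at most
-- slack(x) non-neighbours outside M, and νn ≤ d_M(x) gives slack(x) ≤ (1+ν) d_M(x), so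
--   |X| ≤ (1+ν) Σ_{x∈X} d_M(x)/slack(x) = (1+ν) Σ_{v∈M} w(X ∩ N(v)),
-- where w(S) is the total weight of S.
-- If some v ∈ M had w(X ∩ N(v)) > r − 2, a weighted Turán argument would find a K_{r−1}
-- inside X ∩ N(v), which together with v is a K_r meeting M.
module Submission where

open import Defs hiding (sym)
open import Algebra.Bundles using (Ring)
open import Data.Bool using (true; false; not; _∧_; if_then_else_)
open import Data.Fin using (Fin; zero; suc)
open import Data.Fin.Subset using (Subset; ⊤; _∈_; _∉_; _⊆_; _∩_; ∁; ∣_∣; Nonempty; Empty)
open import Data.Fin.Subset.Properties
  using (nonempty?; _∈?_; x∉p⇒x∈∁p; ∣⊤∣≡n; x∈p∩q⁺; x∈p∩q⁻)
import Data.Integer as ℤ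
import Data.Integer.Properties as ℤ
open import Data.List using (filter; allFin)
import Data.List.Relation.Unary.All as All
open import Data.List.Membership.Propositional.Properties using (∈-filter⁺; ∈-filter⁻; ∈-allFin)
open import Data.Nat using (ℕ; zero; suc; _∸_; _≥_; s≤s)
import Data.Nat.Coprimality as Coprime
open import Data.Product using (∃; _×_; _,_; proj₁; proj₂)
open import Data.Rational
  using (ℚ; _≤_; _<_; _*_; _+_; -_; _-_; 0ℚ; 1ℚ; 1/_; ≢-nonZero; nonNegative)
open import Data.Rational.Properties
open import Data.Rational.Solver using (module +-*-Solver)
open import Data.Sum using (inj₁; inj₂)
open import Data.Vec using ([]; _∷_; lookup)
import Data.Vec.Functional as Vector
open import Data.Vec.Properties
  using (lookup-replicate; lookup-zipWith; lookup-map; lookup∘tabulate; []=⇒lookup; lookup⇒[]=)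
open import Function.Definitions using (Injective)
open import Relation.Binary.Bundles using (DecTotalOrder)
open import Relation.Binary.PropositionalEquality
open import Relation.Nullary using (¬_; Dec; yes; no; contradiction)
open import Relation.Nullary.Decidable using (⌊_⌋)

open import Algebra.Properties.Semiring.Sum (Ring.semiring +-*-ring)
  using (sum; ∑-distrib-+; ∑-comm; *-distribˡ-sum; *-distribʳ-sum; sum-cong-≗; sum-replicate-zero)
open import Data.List.Extrema (DecTotalOrder.totalOrder ≤-decTotalOrder)
  using (argmax; argmax-sel; f[xs]≤f[argmax])
open +-*-Solver using (solve; _:=_; _:+_; _:-_; _:*_; con)

ℕ→ℚ-suc : ∀ k → ℕ→ℚ (suc k) ≡ 1ℚ + ℕ→ℚ k
ℕ→ℚ-suc k rewrite normalize-coprime (Coprime.sym (Coprime.1-coprimeTo k)) =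
  /-cong (sym (cong (ℤ._+_ (ℤ.+ 1)) (ℤ.*-identityʳ (ℤ.+ k)))) refl

ℕ→ℚ-nonNeg : ∀ k → 0ℚ ≤ ℕ→ℚ k
ℕ→ℚ-nonNeg k = nonNegative⁻¹ (ℕ→ℚ k) {{normalize-nonNeg k 1}}

*-nonNeg : ∀ {p q} → 0ℚ ≤ p → 0ℚ ≤ q → 0ℚ ≤ p * q
*-nonNeg {p} {q} p≥0 q≥0 =
  nonNegative⁻¹ (p * q) {{nonNeg*nonNeg⇒nonNeg p {{nonNegative p≥0}} q {{nonNegative q≥0}}}}

-- 1/p, totalised with the junk value recip 0ℚ = 0ℚ.
recip : ℚ → ℚ
recip p with p ≟ 0ℚ
... | yes _   = 0ℚ
... | no p≢0 = 1/_ p {{≢-nonZero p≢0}}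

*-recip : ∀ {p} → 0ℚ < p → p * recip p ≡ 1ℚ
*-recip {p} p>0 with p ≟ 0ℚ
... | yes refl = contradiction p>0 (<-irrefl refl)
... | no p≢0  = *-inverseʳ p {{≢-nonZero p≢0}}

recip-nonNeg : ∀ {p} → 0ℚ ≤ p → 0ℚ ≤ recip p
recip-nonNeg {p} p≥0 with p ≟ 0ℚ
... | yes _   = ≤-refl
... | no p≢0 = <⇒≤ (positive⁻¹ _ {{1/pos⇒pos p {{p>0}}}})
  where p>0 = nonNeg∧nonZero⇒pos p {{nonNegative p≥0}} {{≢-nonZero p≢0}}

∑-mono-≤ : ∀ {n} {f g : Fin n → ℚ} → (∀ i → f i ≤ g i) → sum f ≤ sum g
∑-mono-≤ {zero}  f≤g = ≤-refl
∑-mono-≤ {suc n} f≤g = +-mono-≤ (f≤g zero) (∑-mono-≤ (λ i → f≤g (suc i)))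

𝟙 : ∀ {n} → Subset n → Fin n → ℚ
𝟙 p i = if lookup p i then 1ℚ else 0ℚ

module _ {n : ℕ} where

  𝟙-nonNeg : ∀ (p : Subset n) i → 0ℚ ≤ 𝟙 p i
  𝟙-nonNeg p i with lookup p i
  ... | true  = <⇒≤ (positive⁻¹ 1ℚ)
  ... | false = ≤-refl

  𝟙-∈ : ∀ {p : Subset n} {i} → i ∈ p → 𝟙 p i ≡ 1ℚ
  𝟙-∈ i∈p rewrite []=⇒lookup i∈p = refl

  𝟙-∉ : ∀ {p : Subset n} {i} → i ∉ p → 𝟙 p i ≡ 0ℚ
  𝟙-∉ {p} {i} i∉p with lookup p i in eq
  ... | true  = contradiction (lookup⇒[]= i p eq) i∉p
  ... | false = refl

  𝟙-∩ : ∀ (p q : Subset n) i → 𝟙 (p ∩ q) i ≡ 𝟙 p i * 𝟙 q i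
  𝟙-∩ p q i rewrite lookup-zipWith _∧_ i p q with lookup p i | lookup q i
  ... | true  | true  = refl
  ... | true  | false = refl
  ... | false | true  = refl
  ... | false | false = refl

  𝟙-∁ : ∀ (p : Subset n) i → 𝟙 (∁ p) i ≡ 1ℚ - 𝟙 p i
  𝟙-∁ p i rewrite lookup-map i not p with lookup p i
  ... | true  = refl
  ... | false = refl

  𝟙-mono-⊆ : ∀ {p q : Subset n} → p ⊆ q → ∀ i → 𝟙 p i ≤ 𝟙 q i
  𝟙-mono-⊆ {p} {q} p⊆q i with lookup p i in eq
  ... | true rewrite 𝟙-∈ {q} (p⊆q (lookup⇒[]= i p eq)) = ≤-refl
  ... | false = 𝟙-nonNeg q i

∣p∣≡∑𝟙 : ∀ {n} (p : Subset n) → ℕ→ℚ ∣ p ∣ ≡ sum (𝟙 p)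
∣p∣≡∑𝟙 []          = refl
∣p∣≡∑𝟙 (true ∷ p)  = trans (ℕ→ℚ-suc ∣ p ∣) (cong (1ℚ +_) (∣p∣≡∑𝟙 p))
∣p∣≡∑𝟙 (false ∷ p) = trans (∣p∣≡∑𝟙 p) (sym (+-identityˡ _))

∣∣-mono-⊆ : ∀ {n} {p q : Subset n} → p ⊆ q → ℕ→ℚ ∣ p ∣ ≤ ℕ→ℚ ∣ q ∣
∣∣-mono-⊆ {p = p} {q} p⊆q = begin
  ℕ→ℚ ∣ p ∣ ≡⟨ ∣p∣≡∑𝟙 p ⟩
  sum (𝟙 p) ≤⟨ ∑-mono-≤ (𝟙-mono-⊆ p⊆q) ⟩
  sum (𝟙 q) ≡⟨ ∣p∣≡∑𝟙 q ⟨
  ℕ→ℚ ∣ q ∣ ∎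
  where open ≤-Reasoning

∣∁p∩∁q∣+∣p∣+∣q∣≡n+∣p∩q∣ : ∀ {n} (p q : Subset n) →
  ℕ→ℚ ∣ ∁ p ∩ ∁ q ∣ + ℕ→ℚ ∣ p ∣ + ℕ→ℚ ∣ q ∣ ≡ ℕ→ℚ n + ℕ→ℚ ∣ p ∩ q ∣
∣∁p∩∁q∣+∣p∣+∣q∣≡n+∣p∩q∣ {n} p q = begin
  ℕ→ℚ ∣ ∁ p ∩ ∁ q ∣ + ℕ→ℚ ∣ p ∣ + ℕ→ℚ ∣ q ∣
    ≡⟨ cong₂ _+_ (cong₂ _+_ (∣p∣≡∑𝟙 (∁ p ∩ ∁ q)) (∣p∣≡∑𝟙 p)) (∣p∣≡∑𝟙 q) ⟩
  sum (𝟙 (∁ p ∩ ∁ q)) + sum (𝟙 p) + sum (𝟙 q)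
    ≡⟨ cong (_+ sum (𝟙 q)) (∑-distrib-+ (𝟙 (∁ p ∩ ∁ q)) (𝟙 p)) ⟨
  sum (λ i → 𝟙 (∁ p ∩ ∁ q) i + 𝟙 p i) + sum (𝟙 q)
    ≡⟨ ∑-distrib-+ (λ i → 𝟙 (∁ p ∩ ∁ q) i + 𝟙 p i) (𝟙 q) ⟨
  sum (λ i → 𝟙 (∁ p ∩ ∁ q) i + 𝟙 p i + 𝟙 q i)
    ≡⟨ sum-cong-≗ pointwise ⟩
  sum (λ i → 𝟙 ⊤ i + 𝟙 (p ∩ q) i)
    ≡⟨ ∑-distrib-+ (𝟙 (⊤ {n})) (𝟙 (p ∩ q)) ⟩
  sum (𝟙 (⊤ {n})) + sum (𝟙 (p ∩ q))
    ≡⟨ cong₂ _+_ (trans (cong ℕ→ℚ (sym (∣⊤∣≡n n))) (∣p∣≡∑𝟙 (⊤ {n}))) (∣p∣≡∑𝟙 (p ∩ q)) ⟨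
  ℕ→ℚ n + ℕ→ℚ ∣ p ∩ q ∣ ∎
  where
  open ≡-Reasoning
  pointwise : ∀ i → 𝟙 (∁ p ∩ ∁ q) i + 𝟙 p i + 𝟙 q i ≡ 𝟙 ⊤ i + 𝟙 (p ∩ q) i
  pointwise i rewrite 𝟙-∩ (∁ p) (∁ q) i | 𝟙-∁ p i | 𝟙-∁ q i | 𝟙-∩ p q i | lookup-replicate i true =
    solve 2 (λ a b → (con 1ℚ :- a) :* (con 1ℚ :- b) :+ a :+ b := con 1ℚ :+ a :* b) refl (𝟙 p i) (𝟙 q i)

weight : ∀ {n} → Subset n → (Fin n → ℚ) → ℚ
weight p w = sum (λ i → 𝟙 p i * w i)

module _ {n : ℕ} where

  weight-mono-≤ : ∀ (p : Subset n) {w w′ : Fin n → ℚ} →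
                  (∀ i → i ∈ p → w i ≤ w′ i) → weight p w ≤ weight p w′
  weight-mono-≤ p {w} {w′} w≤w′ = ∑-mono-≤ pointwise
    where
    pointwise : ∀ i → 𝟙 p i * w i ≤ 𝟙 p i * w′ i
    pointwise i with lookup p i in eq
    ... | true  = *-monoˡ-≤-nonNeg 1ℚ (w≤w′ i (lookup⇒[]= i p eq))
    ... | false = ≤-reflexive (trans (*-zeroˡ (w i)) (sym (*-zeroˡ (w′ i))))

  weight-*ˡ : ∀ (p : Subset n) c (w : Fin n → ℚ) → weight p (λ i → c * w i) ≡ c * weight p w
  weight-*ˡ p c w = begin
    sum (λ i → 𝟙 p i * (c * w i)) ≡⟨ sum-cong-≗ (λ i → swap (𝟙 p i) c (w i)) ⟩
    sum (λ i → c * (𝟙 p i * w i)) ≡⟨ *-distribˡ-sum c (λ i → 𝟙 p i * w i) ⟨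
    c * weight p w                 ∎
    where
    open ≡-Reasoning
    swap : ∀ a b e → a * (b * e) ≡ b * (a * e)
    swap = solve 3 (λ a b e → a :* (b :* e) := b :* (a :* e)) refl

  weight-const : ∀ (p : Subset n) c → weight p (λ _ → c) ≡ c * ℕ→ℚ ∣ p ∣
  weight-const p c = begin
    sum (λ i → 𝟙 p i * c) ≡⟨ sum-cong-≗ (λ i → *-comm (𝟙 p i) c) ⟩
    sum (λ i → c * 𝟙 p i) ≡⟨ *-distribˡ-sum c (𝟙 p) ⟨
    c * sum (𝟙 p)         ≡⟨ cong (c *_) (∣p∣≡∑𝟙 p) ⟨
    c * ℕ→ℚ ∣ p ∣         ∎
    where open ≡-Reasoning

  weight≤max*∣p∣ : ∀ (p : Subset n) {w : Fin n → ℚ} {c} → (∀ i → i ∈ p → w i ≤ c) →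
                   weight p w ≤ c * ℕ→ℚ ∣ p ∣
  weight≤max*∣p∣ p {c = c} w≤c = ≤-trans (weight-mono-≤ p w≤c) (≤-reflexive (weight-const p c))

  weight-∩-∁ : ∀ (p q : Subset n) (w : Fin n → ℚ) →
               weight p w ≡ weight (p ∩ q) w + weight (p ∩ ∁ q) w
  weight-∩-∁ p q w =
    trans (sum-cong-≗ split) (∑-distrib-+ (λ i → 𝟙 (p ∩ q) i * w i) (λ i → 𝟙 (p ∩ ∁ q) i * w i))
    where
    split : ∀ i → 𝟙 p i * w i ≡ 𝟙 (p ∩ q) i * w i + 𝟙 (p ∩ ∁ q) i * w i
    split i rewrite 𝟙-∩ p q i | 𝟙-∩ p (∁ q) i | 𝟙-∁ q i =
      solve 3 (λ a b e → a :* e := a :* b :* e :+ a :* (con 1ℚ :- b) :* e) refl (𝟙 p i) (𝟙 q i) (w i)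

  weight-empty : ∀ {p : Subset n} (w : Fin n → ℚ) → Empty p → weight p w ≡ 0ℚ
  weight-empty {p} w p-empty = trans (sum-cong-≗ vanishes) (sum-replicate-zero n)
    where
    vanishes : ∀ i → 𝟙 p i * w i ≡ 0ℚ
    vanishes i = trans (cong (_* w i) (𝟙-∉ (λ i∈p → p-empty (i , i∈p)))) (*-zeroˡ (w i))

max-weight-member : ∀ {n} (p : Subset n) (w : Fin n → ℚ) → Nonempty p →
                    ∃ λ x → x ∈ p × (∀ y → y ∈ p → w y ≤ w x)
max-weight-member {n} p w (x₀ , x₀∈p) = x , x∈p , λ y y∈p →
  All.lookup (f[xs]≤f[argmax] {f = w} x₀ members) (∈-filter⁺ (_∈? p) (∈-allFin y) y∈p)
  where
  members = filter (_∈? p) (allFin n)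
  x = argmax w x₀ members
  x∈p : x ∈ p
  x∈p with argmax-sel w x₀ members
  ... | inj₁ x≡x₀      = subst (_∈ p) (sym x≡x₀) x₀∈p
  ... | inj₂ x∈members = proj₂ (∈-filter⁻ (_∈? p) {xs = allFin n} x∈members)

module _ {n : ℕ} (G : Graph n) where

  ∈N⇒adj : ∀ {x y} → y ∈ N G x → adj G x y ≡ true
  ∈N⇒adj {x} {y} y∈Nx = trans (sym (lookup∘tabulate (adj G x) y)) ([]=⇒lookup y∈Nx)

  ∈N⇒≢ : ∀ {x y} → y ∈ N G x → x ≢ y
  ∈N⇒≢ {x} y∈Nx refl = contradiction (trans (sym (∈N⇒adj y∈Nx)) (irrefl G x)) λ ()

  𝟙-N-sym : ∀ x y → 𝟙 (N G x) y ≡ 𝟙 (N G y) x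
  𝟙-N-sym x y rewrite lookup∘tabulate (adj G x) y | lookup∘tabulate (adj G y) x | Graph.sym G x y =
    refl

  IsClique-[] : IsClique {r = 0} G (λ ())
  IsClique-[] = (λ { {()} }) , λ ()

  IsClique-∷ : ∀ {r x} {g : Fin r → Fin n} → IsClique G g → (∀ a → g a ∈ N G x) →
               IsClique G (x Vector.∷ g)
  IsClique-∷ {x = x} {g} (g-injective , g-adjacent) g⊆Nx = injective , adjacent
    where
    injective : Injective _≡_ _≡_ (x Vector.∷ g)
    injective {zero}  {zero}  _  = refl
    injective {zero}  {suc b} eq = contradiction eq (∈N⇒≢ (g⊆Nx b))
    injective {suc a} {zero}  eq = contradiction (sym eq) (∈N⇒≢ (g⊆Nx a))
    injective {suc a} {suc b} eq = cong suc (g-injective eq)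
    adjacent : ∀ a b → a ≢ b → adj G ((x Vector.∷ g) a) ((x Vector.∷ g) b) ≡ true
    adjacent zero    zero    a≢b = contradiction refl a≢b
    adjacent zero    (suc b) _   = ∈N⇒adj (g⊆Nx b)
    adjacent (suc a) zero    _   = trans (Graph.sym G (g a) x) (∈N⇒adj (g⊆Nx a))
    adjacent (suc a) (suc b) a≢b = g-adjacent a b (λ a≡b → a≢b (cong suc a≡b))

  -- The heaviest vertex x of S has non-neighbours of total weight at most 1, so S ∩ N(x)
  -- weighs more than k - 1; recurse there and add x.
  weighted-clique : ∀ {w : Fin n → ℚ} → (∀ i → 0ℚ ≤ w i) → ∀ k (S : Subset n) →
                    (∀ x → x ∈ S → w x * ℕ→ℚ ∣ S ∩ ∁ (N G x) ∣ ≤ 1ℚ) →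
                    ℕ→ℚ k < weight S w →
                    ∃ λ (g : Fin (suc k) → Fin n) → IsClique G g × (∀ a → g a ∈ S)
  weighted-clique {w} w≥0 k S sparse heavy =
    x Vector.∷ g , IsClique-∷ g-clique (λ a → proj₂ (x∈p∩q⁻ S _ (g⊆S∩Nx a))) , members
    where
    S-nonempty : Nonempty S
    S-nonempty with nonempty? S
    ... | yes S-nonempty = S-nonempty
    ... | no  S-empty    = contradiction
          (<-≤-trans heavy (≤-trans (≤-reflexive (weight-empty w S-empty)) (ℕ→ℚ-nonNeg k)))
          (<-irrefl refl)

    x-max = max-weight-member S w S-nonempty
    x = proj₁ x-max
    x∈S = proj₁ (proj₂ x-max)

    non-neighbours-light : weight (S ∩ ∁ (N G x)) w ≤ 1ℚ
    non-neighbours-light = ≤-trans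
      (weight≤max*∣p∣ (S ∩ ∁ (N G x)) λ y y∈ → proj₂ (proj₂ x-max) y (proj₁ (x∈p∩q⁻ S _ y∈)))
      (sparse x x∈S)

    sparse-Nx : ∀ y → y ∈ S ∩ N G x → w y * ℕ→ℚ ∣ (S ∩ N G x) ∩ ∁ (N G y) ∣ ≤ 1ℚ
    sparse-Nx y y∈ = ≤-trans (*-monoˡ-≤-nonNeg (w y) {{nonNegative (w≥0 y)}} (∣∣-mono-⊆ shrink))
                             (sparse y (proj₁ (x∈p∩q⁻ S _ y∈)))
      where
      shrink : (S ∩ N G x) ∩ ∁ (N G y) ⊆ S ∩ ∁ (N G y)
      shrink z∈ = let z∈S∩Nx , z∉Ny = x∈p∩q⁻ _ _ z∈ in x∈p∩q⁺ (proj₁ (x∈p∩q⁻ S _ z∈S∩Nx) , z∉Ny)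

    clique-in-Nx : ∀ k → ℕ→ℚ k < weight S w →
                   ∃ λ (g : Fin k → Fin n) → IsClique G g × (∀ a → g a ∈ S ∩ N G x)
    clique-in-Nx zero    _     = (λ ()) , IsClique-[] , λ ()
    clique-in-Nx (suc k) heavy = weighted-clique w≥0 k (S ∩ N G x) sparse-Nx
      (≰⇒> λ light → <-irrefl refl (<-≤-trans heavy (begin
        weight S w                                      ≡⟨ weight-∩-∁ S (N G x) w ⟩
        weight (S ∩ N G x) w + weight (S ∩ ∁ (N G x)) w ≤⟨ +-mono-≤ light non-neighbours-light ⟩
        ℕ→ℚ k + 1ℚ                                      ≡⟨ +-comm (ℕ→ℚ k) 1ℚ ⟩
        1ℚ + ℕ→ℚ k                                      ≡⟨ ℕ→ℚ-suc k ⟨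
        ℕ→ℚ (suc k)                                     ∎)))
      where open ≤-Reasoning

    g-data = clique-in-Nx k heavy
    g = proj₁ g-data
    g-clique = proj₁ (proj₂ g-data)
    g⊆S∩Nx = proj₂ (proj₂ g-data)

    members : ∀ a → (x Vector.∷ g) a ∈ S
    members zero    = x∈S
    members (suc a) = proj₁ (x∈p∩q⁻ S _ (g⊆S∩Nx a))

  weighted-degIn-double-count : ∀ (A B : Subset n) (w : Fin n → ℚ) →
    weight A (λ x → ℕ→ℚ (degIn G B x) * w x) ≡ weight B (λ v → weight (A ∩ N G v) w)
  weighted-degIn-double-count A B w = begin
    sum (λ x → 𝟙 A x * (ℕ→ℚ (degIn G B x) * w x))           ≡⟨ sum-cong-≗ expand ⟩
    sum (λ x → sum (λ v → 𝟙 B v * (𝟙 (A ∩ N G v) x * w x))) ≡⟨ ∑-comm summand ⟩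
    sum (λ v → sum (λ x → 𝟙 B v * (𝟙 (A ∩ N G v) x * w x)))
      ≡⟨ sum-cong-≗ (λ v → *-distribˡ-sum (𝟙 B v) (λ x → 𝟙 (A ∩ N G v) x * w x)) ⟨
    sum (λ v → 𝟙 B v * weight (A ∩ N G v) w)                 ∎
    where
    open ≡-Reasoning
    summand : Fin n → Fin n → ℚ
    summand x v = 𝟙 B v * (𝟙 (A ∩ N G v) x * w x)
    swap : ∀ x v → 𝟙 A x * (𝟙 (N G x ∩ B) v * w x) ≡ summand x v
    swap x v rewrite 𝟙-∩ (N G x) B v | 𝟙-∩ A (N G v) x | 𝟙-N-sym x v =
      solve 4 (λ a e b c → a :* (e :* b :* c) := b :* (a :* e :* c)) refl
        (𝟙 A x) (𝟙 (N G v) x) (𝟙 B v) (w x)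
    expand : ∀ x → 𝟙 A x * (ℕ→ℚ (degIn G B x) * w x) ≡ sum (summand x)
    expand x = begin
      𝟙 A x * (ℕ→ℚ ∣ N G x ∩ B ∣ * w x)
        ≡⟨ cong (λ c → 𝟙 A x * (c * w x)) (∣p∣≡∑𝟙 (N G x ∩ B)) ⟩
      𝟙 A x * (sum (𝟙 (N G x ∩ B)) * w x)
        ≡⟨ cong (𝟙 A x *_) (*-distribʳ-sum (w x) (𝟙 (N G x ∩ B))) ⟩
      𝟙 A x * sum (λ v → 𝟙 (N G x ∩ B) v * w x)
        ≡⟨ *-distribˡ-sum (𝟙 A x) (λ v → 𝟙 (N G x ∩ B) v * w x) ⟩
      sum (λ v → 𝟙 A x * (𝟙 (N G x ∩ B) v * w x))
        ≡⟨ sum-cong-≗ (swap x) ⟩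
      sum (summand x) ∎

∈X⁻ : ∀ {n} (G : Graph n) (M : Subset n) ν {x} → x ∈ X G M ν →
      x ∉ M × 1ℚ ≤ ℕ→ℚ (degIn G M x) × ν * ℕ→ℚ n ≤ ℕ→ℚ (degIn G M x)
∈X⁻ {n} G M ν {x} x∈X =
  let x∉?M , 1≤d , νn≤d = unpack (lookup M x) (ℕ→ℚ 1 ≤? ℕ→ℚ (degIn G M x))
                                 (ν * ℕ→ℚ n ≤? ℕ→ℚ (degIn G M x))
                                 (trans (sym (lookup∘tabulate _ x)) ([]=⇒lookup x∈X))
  in (λ x∈M → contradiction (trans (sym x∉?M) ([]=⇒lookup x∈M)) λ ()) , 1≤d , νn≤d
  where
  unpack : ∀ {P Q : Set} b (p : Dec P) (q : Dec Q) →
           not b ∧ ⌊ p ⌋ ∧ ⌊ q ⌋ ≡ true → b ≡ false × P × Q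
  unpack false (yes p) (yes q) _ = refl , p , q

module _ {n : ℕ} (G : Graph n) (M : Subset n) (ν : ℚ) (ν≥0 : 0ℚ ≤ ν) where

  private
    d : Fin n → ℚ
    d x = ℕ→ℚ (degIn G M x)

    ννn≥0 : 0ℚ ≤ ν * ν * ℕ→ℚ n
    ννn≥0 = *-nonNeg (*-nonNeg ν≥0 ν≥0) (ℕ→ℚ-nonNeg n)

  slack : Fin n → ℚ
  slack x = ν * ν * ℕ→ℚ n + d x

  slack⁻¹ : Fin n → ℚ
  slack⁻¹ x = recip (slack x)

  slack-pos : ∀ {x} → x ∈ X G M ν → 0ℚ < slack x
  slack-pos x∈X = <-≤-trans (positive⁻¹ 1ℚ) (+-mono-≤ ννn≥0 (proj₁ (proj₂ (∈X⁻ G M ν x∈X))))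

  slack⁻¹-nonNeg : ∀ x → 0ℚ ≤ slack⁻¹ x
  slack⁻¹-nonNeg x = recip-nonNeg (+-mono-≤ ννn≥0 (ℕ→ℚ-nonNeg (degIn G M x)))

  slack≤[1+ν]d : ∀ {x} → x ∈ X G M ν → slack x ≤ (1ℚ + ν) * d x
  slack≤[1+ν]d {x} x∈X = begin
    ν * ν * ℕ→ℚ n + d x   ≡⟨ cong (_+ d x) (*-assoc ν ν (ℕ→ℚ n)) ⟩
    ν * (ν * ℕ→ℚ n) + d x ≤⟨ +-monoˡ-≤ (d x) (*-monoˡ-≤-nonNeg ν {{nonNegative ν≥0}} νn≤d) ⟩
    ν * d x + d x         ≡⟨ solve 2 (λ a b → a :* b :+ b := (con 1ℚ :+ a) :* b) refl ν (d x) ⟩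
    (1ℚ + ν) * d x        ∎
    where
    open ≤-Reasoning
    νn≤d = proj₂ (proj₂ (∈X⁻ G M ν x∈X))

  1≤[1+ν]d*slack⁻¹ : ∀ {x} → x ∈ X G M ν → 1ℚ ≤ (1ℚ + ν) * (d x * slack⁻¹ x)
  1≤[1+ν]d*slack⁻¹ {x} x∈X = begin
    1ℚ                           ≡⟨ *-recip (slack-pos x∈X) ⟨
    slack x * slack⁻¹ x          ≤⟨ *-monoʳ-≤-nonNeg (slack⁻¹ x) {{nonNegative (slack⁻¹-nonNeg x)}}
                                      (slack≤[1+ν]d x∈X) ⟩
    (1ℚ + ν) * d x * slack⁻¹ x   ≡⟨ *-assoc (1ℚ + ν) (d x) (slack⁻¹ x) ⟩
    (1ℚ + ν) * (d x * slack⁻¹ x) ∎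
    where open ≤-Reasoning

  non-neighbours-outside-M : ∀ x → ℕ→ℚ n - ℕ→ℚ ∣ M ∣ - ν * ν * ℕ→ℚ n ≤ ℕ→ℚ (degree G x) →
                             ℕ→ℚ ∣ ∁ (N G x) ∩ ∁ M ∣ ≤ slack x
  non-neighbours-outside-M x deg≥ = begin
    c
      ≡⟨ solve 3 (λ c D m → c := c :+ D :+ m :- D :- m) refl c D m ⟩
    c + D + m - D - m
      ≡⟨ cong (λ t → t - D - m) (∣∁p∩∁q∣+∣p∣+∣q∣≡n+∣p∩q∣ (N G x) M) ⟩
    ℕ→ℚ n + d x - D - m
      ≤⟨ +-monoˡ-≤ (- m) (+-monoʳ-≤ (ℕ→ℚ n + d x) (neg-antimono-≤ deg≥)) ⟩
    ℕ→ℚ n + d x - (ℕ→ℚ n - m - ννn) - m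
      ≡⟨ solve 4 (λ k e m t → k :+ e :- (k :- m :- t) :- m := t :+ e) refl (ℕ→ℚ n) (d x) m ννn ⟩
    slack x ∎
    where
    open ≤-Reasoning
    c = ℕ→ℚ ∣ ∁ (N G x) ∩ ∁ M ∣
    D = ℕ→ℚ (degree G x)
    m = ℕ→ℚ ∣ M ∣
    ννn = ν * ν * ℕ→ℚ n

  module _ (min-degree : ∀ x → x ∈ X G M ν →
                         ℕ→ℚ n - ℕ→ℚ ∣ M ∣ - ν * ν * ℕ→ℚ n ≤ ℕ→ℚ (degree G x)) where

    X∩N-weight≤ : ∀ k → ¬ KrMeets (suc (suc k)) G M →
                  ∀ v → v ∈ M → weight (X G M ν ∩ N G v) slack⁻¹ ≤ ℕ→ℚ k
    X∩N-weight≤ k no-Kr v v∈M = ≮⇒≥ λ heavy →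
      let g , g-clique , g⊆X∩Nv = weighted-clique G slack⁻¹-nonNeg k (X G M ν ∩ N G v) sparse heavy
          v∷g-clique = IsClique-∷ G g-clique (λ a → proj₂ (x∈p∩q⁻ _ _ (g⊆X∩Nv a)))
      in no-Kr (v Vector.∷ g , v∷g-clique , zero , v∈M)
      where
      sparse : ∀ x → x ∈ X G M ν ∩ N G v → slack⁻¹ x * ℕ→ℚ ∣ (X G M ν ∩ N G v) ∩ ∁ (N G x) ∣ ≤ 1ℚ
      sparse x x∈ = begin
        slack⁻¹ x * ℕ→ℚ ∣ (X G M ν ∩ N G v) ∩ ∁ (N G x) ∣ ≤⟨ scale (∣∣-mono-⊆ outside-M) ⟩
        slack⁻¹ x * ℕ→ℚ ∣ ∁ (N G x) ∩ ∁ M ∣                ≤⟨ scale (non-neighbours-outside-M x (min-degree x x∈X)) ⟩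
        slack⁻¹ x * slack x                                ≡⟨ *-comm (slack⁻¹ x) (slack x) ⟩
        slack x * slack⁻¹ x                                ≡⟨ *-recip (slack-pos x∈X) ⟩
        1ℚ                                                 ∎
        where
        open ≤-Reasoning
        x∈X = proj₁ (x∈p∩q⁻ _ _ x∈)
        scale : ∀ {a b} → a ≤ b → slack⁻¹ x * a ≤ slack⁻¹ x * b
        scale = *-monoˡ-≤-nonNeg (slack⁻¹ x) {{nonNegative (slack⁻¹-nonNeg x)}}
        outside-M : (X G M ν ∩ N G v) ∩ ∁ (N G x) ⊆ ∁ (N G x) ∩ ∁ M
        outside-M z∈ = let z∈X∩Nv , z∉Nx = x∈p∩q⁻ _ _ z∈ in
          x∈p∩q⁺ (z∉Nx , x∉p⇒x∈∁p (proj₁ (∈X⁻ G M ν (proj₁ (x∈p∩q⁻ _ _ z∈X∩Nv)))))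

lemma2p3 : (r : ℕ) → r ≥ 3 → (n : ℕ) → (G : Graph n) → (M : Subset n)
    → ¬ KrMeets r G M
    → (ν : ℚ) → 0ℚ ≤ ν → ν < 1ℚ
    → (∀ x → x ∈ X G M ν → ℕ→ℚ n - ℕ→ℚ ∣ M ∣ - ν * ν * ℕ→ℚ n ≤ ℕ→ℚ (degree G x))
    → ℕ→ℚ ∣ X G M ν ∣ ≤ (1ℚ + ν) * ℕ→ℚ (r ∸ 2) * ℕ→ℚ ∣ M ∣
lemma2p3 (suc (suc k)) (s≤s (s≤s _)) n G M no-Kr ν ν≥0 _ min-degree = begin
  ℕ→ℚ ∣ Xν ∣
    ≡⟨ trans (sym (*-identityˡ _)) (sym (weight-const Xν 1ℚ)) ⟩
  weight Xν (λ _ → 1ℚ)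
    ≤⟨ weight-mono-≤ Xν (λ _ → 1≤[1+ν]d*slack⁻¹ G M ν ν≥0) ⟩
  weight Xν (λ x → (1ℚ + ν) * (d x * w x))
    ≡⟨ weight-*ˡ Xν (1ℚ + ν) (λ x → d x * w x) ⟩
  (1ℚ + ν) * weight Xν (λ x → d x * w x)
    ≡⟨ cong ((1ℚ + ν) *_) (weighted-degIn-double-count G Xν M w) ⟩
  (1ℚ + ν) * weight M (λ v → weight (Xν ∩ N G v) w)
    ≤⟨ *-monoˡ-≤-nonNeg (1ℚ + ν) {{nonNegative 1+ν≥0}}
         (weight≤max*∣p∣ M (X∩N-weight≤ G M ν ν≥0 min-degree k no-Kr)) ⟩
  (1ℚ + ν) * (ℕ→ℚ k * ℕ→ℚ ∣ M ∣)
    ≡⟨ *-assoc (1ℚ + ν) (ℕ→ℚ k) (ℕ→ℚ ∣ M ∣) ⟨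
  (1ℚ + ν) * ℕ→ℚ k * ℕ→ℚ ∣ M ∣ ∎
  where
  open ≤-Reasoning
  Xν = X G M ν
  d : Fin n → ℚ
  d x = ℕ→ℚ (degIn G M x)
  w = slack⁻¹ G M ν ν≥0
  1+ν≥0 : 0ℚ ≤ 1ℚ + ν
  1+ν≥0 = ≤-trans (<⇒≤ (positive⁻¹ 1ℚ))
                  (≤-trans (≤-reflexive (sym (+-identityʳ 1ℚ))) (+-monoʳ-≤ 1ℚ ν≥0))
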